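{- Consider the core logic for exceptions extended as follows: for each propagator $b:P\to Y$ there is a catcher $\mathtt{CATCH}(b):Y\to Y$ with axioms $\mathtt{CATCH}(b)\sim\mathrm{id}_Y$ and $\mathtt{CATCH}(b)\circ[\,]_Y\equiv b\circ\mathtt{untag}$; and for each propagator $a:X\to Y$ and catcher $k:Y\to Y$ there is a propagator $\mathtt{TRY}(a,k):X\to Y$ with axiom $\mathtt{TRY}(a,k)\sim k\circ a$. Define $\mathtt{throw}_Y=[\,]_Y\circ\mathtt{tag}:P\to Y$ and $\mathtt{try}(a)\mathtt{catch}(b)=\mathtt{TRY}(a,\mathtt{CATCH}(b))$. Assume that for each type $Y$ the pure term $[\,]_Y:\mathbb{0}\to Y$ is a monomorphism with respect to propagators. Then the translations of the rules of the decorated logic for exceptions hold, namely: (propagate) for every propagator $a:X\to Y$, $a\circ[\,]_X\circ\mathtt{tag}\equiv[\,]_Y\circ\mathtt{tag}$; (recover) for pure $u_1,u_2:X\to P$, if $[\,]_Y\circ\mathtt{tag}\circ u_1\equiv[\,]_Y\circ\mathtt{tag}\circ u_2$ then $u_1\equiv u_2$; (try) for propagators $a_1,a_2:X\to Y$ and $b:P\to Y$, if $a_1\equiv a_2$ then $\mathtt{TRY}(a_1,\mathtt{CATCH}(b))\equiv\mathtt{TRY}(a_2,\mathtt{CATCH}(b))$; (try$_0$) for pure $u:X\to Y$ and propagator $b:P\to Y$, $\mathtt{TRY}(u,\mathtt{CATCH}(b))\equiv u$; (try$_1$) for pure $u:X\to P$ and propagator $b:P\to Y$, $\mathtt{TRY}([\,]_Y\circ\mathtt{tag}\circ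 u,\mathtt{CATCH}(b))\equiv b\circ u$.
   Context: Monadic equational logic $L_{eqn}$ (with empty type): types and terms generated by a signature of unary operations, terms being composable paths (with identities); an empty type $\mathbb{0}$ with a term $[\,]_Y:\mathbb{0}\to Y$ for each $Y$. Rules: $\equiv$ is an equivalence relation; (subs) from $v_1\equiv v_2:Y\to Z$ and $u:X\to Y$ infer $v_1\circ u\equiv v_2\circ u$; (repl) from $v_1\equiv v_2:X\to Y$ and $w:Y\to Z$ infer $w\circ v_1\equiv w\circ v_2$; (initial) every $u:\mathbb{0}\to Y$ satisfies $u\equiv[\,]_Y$. Core logic for exceptions $L_{excore}$: pure part $L_{eqn}$ with distinguished type $P$. Terms are composites of pure terms, $\mathtt{tag}:P\to\mathbb{0}$ (decoration $(1)$) and $\mathtt{untag}:\mathbb{0}\to P$ (decoration $(2)$) (and, in the extension, the new terms $\mathtt{CATCH}(b)$ of decoration $(2)$ and $\mathtt{TRY}(a,k)$ of decoration $(1)$); decoration of a composite is the maximum; pure terms have decoration $(0)$; propagators have decoration at most $(1)$; all terms are catchers. Formulas: strong equations $f\equiv g$ and weak equations $f\sim g$. Rules: for $\equiv$: equivalence, (subs), (repl) for all decorations; for $\sim$: equivalence and (repl) for all decorations, (subs) only with a pure substituted term $u$; (empty$_\sim$) every $f:\mathbb{0}\to Y$ satisfies $f\sim[\,]_Y$; $f\equiv g$ implies $f\sim g$; (ax) $\mathtt{untag}\circ\mathtt{tag}\sim\mathrm{id}_P$; (eq$_1$) if $f_1\sim f_2$ with $f_1,f_2$ propagators then $f_1\equiv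 f_2$; (eq$_2$) for $f_1,f_2:X\to Y$, $f_1\sim f_2$ and $f_1\circ[\,]_X\equiv f_2\circ[\,]_X$ imply $f_1\equiv f_2$; (eq$_3$) for $f_1,f_2:\mathbb{0}\to X$, $f_1\circ\mathtt{tag}\sim f_2\circ\mathtt{tag}$ implies $f_1\equiv f_2$; plus the rules of $L_{eqn}$ for pure terms. All equations are understood in the theory generated by a fixed theory $T_{eqn}$ of $L_{eqn}$ together with the axioms of the extension. The term $[\,]_Y$ is a monomorphism with respect to propagators if for all propagators $a_1,a_2:X\to\mathbb{0}$, $[\,]_Y\circ a_1\equiv[\,]_Y\circ a_2$ implies $a_1\equiv a_2$. -}

module Defs where

open import Data.Unit using (⊤)
open import Data.Empty using (⊥)
open import Relation.Binary.PropositionalEquality using (_≡_)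
open import Data.Product using (_×_)

data Ty (B : Set) : Set where
  𝟘 : Ty B
  base : B → Ty B

-- Decorations: (0) pure, (1) propagator, (2) catcher.
data Deco : Set where
  pure ppg ctc : Deco

_⊔_ : Deco → Deco → Deco
pure ⊔ e = e
ppg ⊔ pure = ppg
ppg ⊔ ppg = ppg
ppg ⊔ ctc = ctc
ctc ⊔ e = ctc

IsPpg : Deco → Set
IsPpg pure = ⊤
IsPpg ppg = ⊤
IsPpg ctc = ⊥

record Theory : Set₁ where
  field
    B  : Set
    Op : Ty B → Ty B → Set
    P  : Ty B

module Syntax (Σ₀ : Theory) where
  open Theory Σ₀

  -- Terms are composable paths of atoms (list of atoms, last-applied first);
  -- the empty path is the identity. Decorations are computed mutually.
  data Atom : Ty B → Ty B → Set
  data Path : Ty B → Ty B → Set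
  decoA : ∀ {X Y} → Atom X Y → Deco
  decoP : ∀ {X Y} → Path X Y → Deco

  data Atom where
    op    : ∀ {X Y} → Op X Y → Atom X Y
    emp   : ∀ {Y} → Atom 𝟘 Y
    tag   : Atom P 𝟘
    untag : Atom 𝟘 P
    CATCHₐ : ∀ {Y} (b : Path P Y) → IsPpg (decoP b) → Atom Y Y
    TRYₐ   : ∀ {X Y} (a : Path X Y) → IsPpg (decoP a) → (k : Path Y Y) → Atom X Y

  data Path where
    idP : ∀ {X} → Path X X
    _◂_ : ∀ {X Y Z} → Atom Y Z → Path X Y → Path X Z

  decoA (op _) = pure
  decoA emp = pure
  decoA tag = ppg
  decoA untag = ctc
  decoA (CATCHₐ _ _) = ctc
  decoA (TRYₐ _ _ _) = ppg

  decoP idP = pure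
  decoP (a ◂ p) = decoA a ⊔ decoP p

  infixr 9 _∘_
  _∘_ : ∀ {X Y Z} → Path Y Z → Path X Y → Path X Z
  idP ∘ q = q
  (a ◂ p) ∘ q = a ◂ (p ∘ q)

  Pure : ∀ {X Y} → Path X Y → Set
  Pure f = decoP f ≡ pure

  Propagator : ∀ {X Y} → Path X Y → Set
  Propagator f = IsPpg (decoP f)

  ⟨_⟩ : ∀ {X Y} → Atom X Y → Path X Y
  ⟨ a ⟩ = a ◂ idP

  []⟨_⟩ : ∀ Y → Path 𝟘 Y
  []⟨ Y ⟩ = ⟨ emp ⟩

  tagT : Path P 𝟘
  tagT = ⟨ tag ⟩

  untagT : Path 𝟘 P
  untagT = ⟨ untag ⟩

  CATCH : ∀ {Y} (b : Path P Y) → Propagator b → Path Y Y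
  CATCH b pb = ⟨ CATCHₐ b pb ⟩

  TRY : ∀ {X Y} (a : Path X Y) → Propagator a → Path Y Y → Path X Y
  TRY a pa k = ⟨ TRYₐ a pa k ⟩

  throw : ∀ Y → Path P Y
  throw Y = []⟨ Y ⟩ ∘ tagT

  tryCatch : ∀ {X Y} (a : Path X Y) → Propagator a → (b : Path P Y) → Propagator b → Path X Y
  tryCatch a pa b pb = TRY a pa (CATCH b pb)

  Axioms : Set₁
  Axioms = ∀ {X Y} → Path X Y → Path X Y → Set

module Logic (Σ₀ : Theory) (Ax : Syntax.Axioms Σ₀) where
  open Theory Σ₀
  open Syntax Σ₀

  infix 4 _≡ₛ_ _∼_
  data _≡ₛ_ : ∀ {X Y} → Path X Y → Path X Y → Set
  data _∼_  : ∀ {X Y} → Path X Y → Path X Y → Set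

  data _≡ₛ_ where
    ≡-refl  : ∀ {X Y} {f : Path X Y} → f ≡ₛ f
    ≡-sym   : ∀ {X Y} {f g : Path X Y} → f ≡ₛ g → g ≡ₛ f
    ≡-trans : ∀ {X Y} {f g h : Path X Y} → f ≡ₛ g → g ≡ₛ h → f ≡ₛ h
    ≡-subs  : ∀ {X Y Z} {v₁ v₂ : Path Y Z} (u : Path X Y) → v₁ ≡ₛ v₂ → v₁ ∘ u ≡ₛ v₂ ∘ u
    ≡-repl  : ∀ {X Y Z} {v₁ v₂ : Path X Y} (w : Path Y Z) → v₁ ≡ₛ v₂ → w ∘ v₁ ≡ₛ w ∘ v₂
    ≡-ax      : ∀ {X Y} {u v : Path X Y} → Pure u → Pure v → Ax u v → u ≡ₛ v
    ≡-initial : ∀ {Y} (u : Path 𝟘 Y) → Pure u → u ≡ₛ []⟨ Y ⟩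
    eq₁ : ∀ {X Y} {f₁ f₂ : Path X Y} → Propagator f₁ → Propagator f₂ → f₁ ∼ f₂ → f₁ ≡ₛ f₂
    eq₂ : ∀ {X Y} {f₁ f₂ : Path X Y} → f₁ ∼ f₂ → f₁ ∘ []⟨ X ⟩ ≡ₛ f₂ ∘ []⟨ X ⟩ → f₁ ≡ₛ f₂
    eq₃ : ∀ {X} {f₁ f₂ : Path 𝟘 X} → f₁ ∘ tagT ∼ f₂ ∘ tagT → f₁ ≡ₛ f₂
    ax-catch-≡ : ∀ {Y} (b : Path P Y) (pb : Propagator b) → CATCH b pb ∘ []⟨ Y ⟩ ≡ₛ b ∘ untagT

  data _∼_ where
    ∼-refl  : ∀ {X Y} {f : Path X Y} → f ∼ f
    ∼-sym   : ∀ {X Y} {f g : Path X Y} → f ∼ g → g ∼ f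
    ∼-trans : ∀ {X Y} {f g h : Path X Y} → f ∼ g → g ∼ h → f ∼ h
    ∼-subs  : ∀ {X Y Z} {v₁ v₂ : Path Y Z} (u : Path X Y) → Pure u → v₁ ∼ v₂ → v₁ ∘ u ∼ v₂ ∘ u
    ∼-repl  : ∀ {X Y Z} {v₁ v₂ : Path X Y} (w : Path Y Z) → v₁ ∼ v₂ → w ∘ v₁ ∼ w ∘ v₂
    ∼-empty : ∀ {Y} (f : Path 𝟘 Y) → f ∼ []⟨ Y ⟩
    ≡⇒∼     : ∀ {X Y} {f g : Path X Y} → f ≡ₛ g → f ∼ g
    ax-tag  : untagT ∘ tagT ∼ idP
    ax-catch-∼ : ∀ {Y} (b : Path P Y) (pb : Propagator b) → CATCH b pb ∼ idP
    ax-try     : ∀ {X Y} (a : Path X Y) (pa : Propagator a) (k : Path Y Y) → TRY a pa k ∼ k ∘ a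

  EmptyMono : Ty B → Set
  EmptyMono Y = ∀ {X} (a₁ a₂ : Path X 𝟘) → Propagator a₁ → Propagator a₂ →
                []⟨ Y ⟩ ∘ a₁ ≡ₛ []⟨ Y ⟩ ∘ a₂ → a₁ ≡ₛ a₂

-- Each rule is first derived as a weak equation between propagators, using the axioms
-- of TRY and CATCH, tag/untag and the emptiness of 𝟘; rule (eq₁) then makes it strong.
-- The monomorphism hypothesis on [ ] is needed only for (recover), to strip [ ] off
-- [ ] ∘ tag ∘ u before cancelling tag with untag.
module Submission where

open import Defs
open import Data.Product using (_×_; _,_)
open import Data.Unit using (tt)
open import Relation.Binary.Bundles using (Setoid)
open import Relation.Binary.PropositionalEquality using (_≡_; refl; cong; subst)
import Relation.Binary.Reasoning.Setoid as SetoidReasoning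

⊔-isPpg⁻ : ∀ d e → IsPpg (d ⊔ e) → IsPpg d × IsPpg e
⊔-isPpg⁻ pure pure _ = tt , tt
⊔-isPpg⁻ pure ppg  _ = tt , tt
⊔-isPpg⁻ ppg  pure _ = tt , tt
⊔-isPpg⁻ ppg  ppg  _ = tt , tt
⊔-isPpg⁻ pure ctc  ()
⊔-isPpg⁻ ppg  ctc  ()
⊔-isPpg⁻ ctc  _    ()

⊔-isPpg⁺ : ∀ d e → IsPpg d → IsPpg e → IsPpg (d ⊔ e)
⊔-isPpg⁺ pure pure _ _ = tt
⊔-isPpg⁺ pure ppg  _ _ = tt
⊔-isPpg⁺ ppg  pure _ _ = tt
⊔-isPpg⁺ ppg  ppg  _ _ = tt

module Derivations (Σ₀ : Theory) (Ax : Syntax.Axioms Σ₀) where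
  open Theory Σ₀
  open Syntax Σ₀
  open Logic Σ₀ Ax

  ∘-assoc : ∀ {W X Y Z} (f : Path Y Z) (g : Path X Y) (h : Path W X) →
            (f ∘ g) ∘ h ≡ f ∘ (g ∘ h)
  ∘-assoc idP     g h = refl
  ∘-assoc (a ◂ f) g h = cong (a ◂_) (∘-assoc f g h)

  ∘-identityʳ : ∀ {X Y} (f : Path X Y) → f ∘ idP ≡ f
  ∘-identityʳ idP     = refl
  ∘-identityʳ (a ◂ f) = cong (a ◂_) (∘-identityʳ f)

  pure⇒propagator : ∀ {X Y} (f : Path X Y) → Pure f → Propagator f
  pure⇒propagator f pf rewrite pf = tt

  ∘-propagator : ∀ {X Y Z} (f : Path Y Z) (g : Path X Y) →
                 Propagator f → Propagator g → Propagator (f ∘ g)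
  ∘-propagator idP     g _  pg = pg
  ∘-propagator (a ◂ f) g pf pg with ⊔-isPpg⁻ (decoA a) (decoP f) pf
  ... | pa , pf′ = ⊔-isPpg⁺ (decoA a) (decoP (f ∘ g)) pa (∘-propagator f g pf′ pg)

  ∼-setoid : Ty B → Ty B → Setoid _ _
  ∼-setoid X Y = record
    { Carrier       = Path X Y
    ; _≈_           = _∼_
    ; isEquivalence = record { refl = ∼-refl ; sym = ∼-sym ; trans = ∼-trans }
    }

  module ∼-Reasoning {X Y : Ty B} = SetoidReasoning (∼-setoid X Y)

  propagator-from-𝟘 : ∀ {Y} (a : Path 𝟘 Y) → Propagator a → a ≡ₛ []⟨ Y ⟩
  propagator-from-𝟘 a pa = eq₁ pa tt (∼-empty a)

  propagate : ∀ {X Y} (a : Path X Y) → Propagator a →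
              a ∘ []⟨ X ⟩ ∘ tagT ≡ₛ throw Y
  propagate {X} a pa =
    subst (_≡ₛ _) (∘-assoc a []⟨ X ⟩ tagT)
      (≡-subs tagT (propagator-from-𝟘 (a ∘ []⟨ X ⟩) (∘-propagator a []⟨ X ⟩ pa tt)))

  tag-cancelˡ-pure : ∀ {X} (u₁ u₂ : Path X P) → Pure u₁ → Pure u₂ →
                     tagT ∘ u₁ ≡ₛ tagT ∘ u₂ → u₁ ≡ₛ u₂
  tag-cancelˡ-pure u₁ u₂ p₁ p₂ t =
    eq₁ (pure⇒propagator u₁ p₁) (pure⇒propagator u₂ p₂) (begin
      u₁                   ≈⟨ ∼-subs u₁ p₁ ax-tag ⟨
      untagT ∘ tagT ∘ u₁   ≈⟨ ≡⇒∼ (≡-repl untagT t) ⟩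
      untagT ∘ tagT ∘ u₂   ≈⟨ ∼-subs u₂ p₂ ax-tag ⟩
      u₂                   ∎)
    where open ∼-Reasoning

  recover : ∀ {X Y} → EmptyMono Y → (u₁ u₂ : Path X P) → Pure u₁ → Pure u₂ →
            throw Y ∘ u₁ ≡ₛ throw Y ∘ u₂ → u₁ ≡ₛ u₂
  recover mono u₁ u₂ p₁ p₂ h =
    tag-cancelˡ-pure u₁ u₂ p₁ p₂
      (mono (tagT ∘ u₁) (tagT ∘ u₂)
            (∘-propagator tagT u₁ tt (pure⇒propagator u₁ p₁))
            (∘-propagator tagT u₂ tt (pure⇒propagator u₂ p₂)) h)

  TRY-cong : ∀ {X Y} {a₁ a₂ : Path X Y} (p₁ : Propagator a₁) (p₂ : Propagator a₂)
             (k : Path Y Y) → a₁ ≡ₛ a₂ → TRY a₁ p₁ k ≡ₛ TRY a₂ p₂ k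
  TRY-cong {a₁ = a₁} {a₂} p₁ p₂ k e = eq₁ tt tt (begin
    TRY a₁ p₁ k   ≈⟨ ax-try a₁ p₁ k ⟩
    k ∘ a₁        ≈⟨ ≡⇒∼ (≡-repl k e) ⟩
    k ∘ a₂        ≈⟨ ax-try a₂ p₂ k ⟨
    TRY a₂ p₂ k   ∎)
    where open ∼-Reasoning

  try-catch-pure : ∀ {X Y} (u : Path X Y) → Pure u → (pu : Propagator u)
                   (b : Path P Y) (pb : Propagator b) → TRY u pu (CATCH b pb) ≡ₛ u
  try-catch-pure u uPure pu b pb = eq₁ tt pu (begin
    TRY u pu (CATCH b pb)   ≈⟨ ax-try u pu (CATCH b pb) ⟩
    CATCH b pb ∘ u          ≈⟨ ∼-subs u uPure (ax-catch-∼ b pb) ⟩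
    u                       ∎)
    where open ∼-Reasoning

  catch-throw : ∀ {Y} (b : Path P Y) (pb : Propagator b) → CATCH b pb ∘ throw Y ∼ b
  catch-throw {Y} b pb = begin
    CATCH b pb ∘ []⟨ Y ⟩ ∘ tagT   ≈⟨ ≡⇒∼ (≡-subs tagT (ax-catch-≡ b pb)) ⟩
    (b ∘ untagT) ∘ tagT           ≡⟨ ∘-assoc b untagT tagT ⟩
    b ∘ untagT ∘ tagT             ≈⟨ ∼-repl b ax-tag ⟩
    b ∘ idP                       ≡⟨ ∘-identityʳ b ⟩
    b                             ∎
    where open ∼-Reasoning

  try-catch-throw : ∀ {X Y} (u : Path X P) → Pure u → (pt : Propagator (throw Y ∘ u))
                    (b : Path P Y) (pb : Propagator b) →
                    TRY (throw Y ∘ u) pt (CATCH b pb) ≡ₛ b ∘ u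
  try-catch-throw {Y = Y} u uPure pt b pb =
    eq₁ tt (∘-propagator b u pb (pure⇒propagator u uPure)) (begin
      TRY (throw Y ∘ u) pt (CATCH b pb)   ≈⟨ ax-try (throw Y ∘ u) pt (CATCH b pb) ⟩
      CATCH b pb ∘ throw Y ∘ u            ≈⟨ ∼-subs u uPure (catch-throw b pb) ⟩
      b ∘ u                               ∎)
    where open ∼-Reasoning

proposition4p2 : (Σ₀ : Theory) (Ax : Syntax.Axioms Σ₀) →
    let open Theory Σ₀ in let open Syntax Σ₀ in let open Logic Σ₀ Ax in
    (∀ Y → EmptyMono Y) →
    (∀ {X Y} (a : Path X Y) → Propagator a →
      a ∘ []⟨ X ⟩ ∘ tagT ≡ₛ []⟨ Y ⟩ ∘ tagT)
    × (∀ {X Y} (u₁ u₂ : Path X P) → Pure u₁ → Pure u₂ →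
      []⟨ Y ⟩ ∘ tagT ∘ u₁ ≡ₛ []⟨ Y ⟩ ∘ tagT ∘ u₂ → u₁ ≡ₛ u₂)
    × (∀ {X Y} (a₁ a₂ : Path X Y) (p₁ : Propagator a₁) (p₂ : Propagator a₂)
      (b : Path P Y) (pb : Propagator b) →
      a₁ ≡ₛ a₂ → TRY a₁ p₁ (CATCH b pb) ≡ₛ TRY a₂ p₂ (CATCH b pb))
    × (∀ {X Y} (u : Path X Y) (pu : Pure u) (b : Path P Y) (pb : Propagator b) →
      (pu′ : Propagator u) → TRY u pu′ (CATCH b pb) ≡ₛ u)
    × (∀ {X Y} (u : Path X P) → Pure u → (b : Path P Y) (pb : Propagator b) →
      (pt : Propagator ([]⟨ Y ⟩ ∘ tagT ∘ u)) →
      TRY ([]⟨ Y ⟩ ∘ tagT ∘ u) pt (CATCH b pb) ≡ₛ b ∘ u)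
proposition4p2 Σ₀ Ax mono =
    propagate
  , (λ {_} {Y} → recover (mono Y))
  , (λ a₁ a₂ p₁ p₂ b pb → TRY-cong p₁ p₂ (CATCH b pb))
  , (λ u uPure b pb pu → try-catch-pure u uPure pu b pb)
  , (λ u uPure b pb pt → try-catch-throw u uPure pt b pb)
  where
    open Syntax Σ₀
    open Derivations Σ₀ Ax
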